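{- Let $k,m,n\geq 2$ and let $\Sigma$ be an alphabet with $|\Sigma|=k$. The $(m,n)_k$-ring graph is weakly connected.
   Context: $\Sigma$ is a finite totally ordered alphabet; $\Sigma^{m,n}$ denotes the set of $m\times n$ arrays (patterns) over $\Sigma$, and for arrays $X,Y$ with the same number of rows $[X,Y]$ denotes horizontal concatenation. For a pattern $P$ with rows $r_1,\dots,r_m\in\Sigma^{n}$, view $P$ as the word $[r_1,\dots,r_m]$ over the alphabet $\Sigma^n$ (ordered lexicographically). $P$ is row-Lyndon if this word is a Lyndon word (strictly smaller lexicographically than all its nontrivial cyclic rotations). $lexmin(P)$ denotes the cyclic rotation of the rows of $P$ whose corresponding word is lexicographically smallest. The $(m,n)_k$-ring graph is the labeled multidigraph whose vertex set is $\{lexmin(S)\mid S\in\Sigma^{m,n-1}\}$ and which, for vertices $P_1,P_2$, has one edge from $P_1$ to $P_2$ with label $R$ for each $R\in\Sigma^{m,1}$ such that there exist $L\in\Sigma^{m,1}$, $C\in\Sigma^{m,n-2}$ with: (1) $P_1=[L,C]$ and $P_2=lexmin([C,R])$; (2) $lexmin([L,C,R])$ is a row-Lyndon pattern of shape $(m,n)$; (3) there is no $R'\in\Sigma^{m,1}$ with $R'<R$ and $lexmin([L,C,R'])=lexmin([L,C,R])$. (Distinct applicable labels give distinct parallel edges.) -}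

module Defs where

open import Level using (0ℓ)
open import Data.Nat using (ℕ; zero; suc; _≤_; _<_)
open import Data.Fin using (Fin)
import Data.Fin.Properties as FinP
open import Data.Vec using (Vec; []; _∷_; _∷ʳ_; zipWith; _++_; head)
import Data.Vec.Relation.Binary.Lex.Strict as VLex
open import Data.Product using (Σ; ∃; _×_; _,_; proj₁)
open import Relation.Nullary using (¬_; yes; no)
open import Relation.Binary using (StrictTotalOrder; Rel)
open import Relation.Binary.PropositionalEquality using (_≡_)
open import Relation.Binary.Construct.Closure.Equivalence using (EqClosure)

-- The alphabet Σ with |Σ| = k is Fin k with its usual total order.
-- An (m,n)-pattern over Σ is an m×n array, stored as a vector of its m rows,
-- each row a vector of n letters.
Pattern : ℕ → ℕ → ℕ → Set
Pattern k m n = Vec (Vec (Fin k) n) m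

RowOrder : ℕ → ℕ → StrictTotalOrder 0ℓ 0ℓ 0ℓ
RowOrder k n = VLex.<-strictTotalOrder (FinP.<-strictTotalOrder k) n

WordOrder : ℕ → ℕ → ℕ → StrictTotalOrder 0ℓ 0ℓ 0ℓ
WordOrder k m n = VLex.<-strictTotalOrder (RowOrder k n) m

_<W_ : ∀ {k m n} → Rel (Pattern k m n) 0ℓ
_<W_ {k} {m} {n} = StrictTotalOrder._<_ (WordOrder k m n)

hcat : ∀ {k m a b} → Pattern k m a → Pattern k m b → Pattern k m (a Data.Nat.+ b)
hcat X Y = zipWith _++_ X Y

hcatCol : ∀ {k m a} → Pattern k m a → Pattern k m 1 → Pattern k m (suc a)
hcatCol X R = zipWith (λ r col → r ∷ʳ head col) X R

rot : ∀ {A : Set} {m} → Vec A m → Vec A m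
rot []       = []
rot (x ∷ xs) = xs ∷ʳ x

rotN : ∀ {A : Set} {m} → ℕ → Vec A m → Vec A m
rotN zero    xs = xs
rotN (suc i) xs = rotN i (rot xs)

RowLyndon : ∀ {k m n} → Pattern k m n → Set
RowLyndon {m = m} P = ∀ i → 1 ≤ i → i < m → P <W rotN i P

private
  lexminGo : ∀ {k m n} → ℕ → Pattern k m n → Pattern k m n → Pattern k m n
  lexminGo zero    cur best = best
  lexminGo {k} {m} {n} (suc j) cur best with StrictTotalOrder._<?_ (WordOrder k m n) cur best
  ... | yes _ = lexminGo j (rot cur) cur
  ... | no  _ = lexminGo j (rot cur) best

lexmin : ∀ {k m n} → Pattern k m n → Pattern k m n
lexmin {m = m} P = lexminGo m P P

-- The (m,n)_k-ring graph, for n = 2 + c (so vertices have shape (m, 1 + c)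
-- and the middle block C has shape (m, c)).
IsVertex : ∀ k m c → Pattern k m (suc c) → Set
IsVertex k m c P = ∃ λ (S : Pattern k m (suc c)) → P ≡ lexmin S

Vertex : ℕ → ℕ → ℕ → Set
Vertex k m c = Σ (Pattern k m (suc c)) (IsVertex k m c)

Edge : ∀ {k m c} → Pattern k m (suc c) → Pattern k m (suc c) → Pattern k m 1 → Set
Edge {k} {m} {c} P₁ P₂ R =
  Σ (Pattern k m 1) λ L → Σ (Pattern k m c) λ C →
      (P₁ ≡ hcat L C)
    × (P₂ ≡ lexmin (hcatCol C R))
    × RowLyndon (lexmin (hcatCol (hcat L C) R))
    × (¬ ∃ λ (R' : Pattern k m 1) →
           (R' <W R) × (lexmin (hcatCol (hcat L C) R') ≡ lexmin (hcatCol (hcat L C) R)))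

RingAdj : ∀ k m c → Rel (Vertex k m c) 0ℓ
RingAdj k m c u v = ∃ λ (R : Pattern k m 1) → Edge {k} {m} {c} (proj₁ u) (proj₁ v) R

RingGraphWeaklyConnected : ℕ → ℕ → ℕ → Set
RingGraphWeaklyConnected k m c = ∀ (u v : Vertex k m c) → EqClosure (RingAdj k m c) u v

{-# OPTIONS --safe #-}
module Submission where

-- Let D be the column (0,…,0,1), which is aperiodic. From any vertex, drop the
-- first column and append a rotation of D, n − 1 times; the rotation is chosen
-- so that, undoing all rotations performed by lexmin, D is always appended in
-- the same position. Then every row ends up constant, so every vertex is
-- joined to the vertex whose i-th row is constantly D_i. Each step is an edge:
-- as the appended column is aperiodic, the rotations of the new pattern are
-- pairwise distinct and its lexmin is row-Lyndon; and no smaller label gives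
-- the same lexmin, because a column below D is constantly 0, while at later
-- steps the last column of the vertex already equals the label, and comparing
-- the last two columns of two equal rotations forces the labels to coincide.

open import Defs
open import Data.Empty using (⊥-elim)
open import Data.Fin as Fin using (Fin)
open import Data.List as List using (List; _++_; [_]; length)
import Data.List.Properties as List
open import Data.Nat using (ℕ; zero; suc; _+_; _*_; _∸_; _≤_; _<_; s≤s; _%_; _/_)
open import Data.Nat.DivMod using (m≡m%n+[m/n]*n; m%n<n)
open import Data.Nat.Properties using (+-comm; *-suc; m+[n∸m]≡n)
open import Data.Product using (∃; ∃₂; _×_; _,_; proj₁)
open import Data.Sum using (_⊎_; inj₁; inj₂; map₂)
open import Data.Vec using (Vec; []; _∷_; _∷ʳ_; map; zipWith; replicate; toList; head; tail; last; init)
import Data.Vec.Properties as Vec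
open import Data.Vec.Relation.Binary.Equality.Cast using (cast-is-id)
open import Data.Vec.Relation.Binary.Lex.Core using (this; next; base)
open import Data.Vec.Relation.Binary.Pointwise.Inductive using (Pointwise; Pointwise-≡⇒≡)
import Data.Vec.Relation.Binary.Pointwise.Inductive as Pointwise
open import Relation.Binary using (StrictTotalOrder; tri<; tri≈; tri>)
import Relation.Binary.Construct.Closure.Equivalence as EqClosure
open EqClosure using (EqClosure)
open import Relation.Binary.Construct.Closure.ReflexiveTransitive using (ε; _◅_)
open import Relation.Binary.Construct.Closure.Symmetric using (fwd)
open import Relation.Binary.PropositionalEquality
  using (_≡_; _≢_; refl; sym; trans; cong; cong₂; subst; subst₂; module ≡-Reasoning)
open import Relation.Nullary using (¬_; Dec; yes; no)

private
  variable
    A B C : Set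
    k m n : ℕ

-- Rotations

rot-injective : (xs ys : Vec A m) → rot xs ≡ rot ys → xs ≡ ys
rot-injective []       []       _  = refl
rot-injective (x ∷ xs) (y ∷ ys) eq with Vec.∷ʳ-injective xs ys eq
... | refl , refl = refl

rotN-injective : ∀ t (xs ys : Vec A m) → rotN t xs ≡ rotN t ys → xs ≡ ys
rotN-injective zero    xs ys eq = eq
rotN-injective (suc t) xs ys eq = rot-injective xs ys (rotN-injective t (rot xs) (rot ys) eq)

rotN-+ : ∀ a b (xs : Vec A m) → rotN (a + b) xs ≡ rotN b (rotN a xs)
rotN-+ zero    b xs = refl
rotN-+ (suc a) b xs = rotN-+ a b (rot xs)

rotN-comm : ∀ a b (xs : Vec A m) → rotN a (rotN b xs) ≡ rotN b (rotN a xs)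
rotN-comm a b xs = begin
  rotN a (rotN b xs) ≡⟨ rotN-+ b a xs ⟨
  rotN (b + a) xs    ≡⟨ cong (λ t → rotN t xs) (+-comm b a) ⟩
  rotN (a + b) xs    ≡⟨ rotN-+ a b xs ⟩
  rotN b (rotN a xs) ∎
  where open ≡-Reasoning

map-rotN : ∀ t (f : A → B) (xs : Vec A m) → map f (rotN t xs) ≡ rotN t (map f xs)
map-rotN zero    f xs       = refl
map-rotN (suc t) f []       = map-rotN t f []
map-rotN (suc t) f (x ∷ xs) = trans (map-rotN t f (xs ∷ʳ x)) (cong (rotN t) (Vec.map-∷ʳ f x xs))

zipWith-∷ʳ : ∀ (f : A → B → C) (xs : Vec A m) ys x y →
             zipWith f (xs ∷ʳ x) (ys ∷ʳ y) ≡ zipWith f xs ys ∷ʳ f x y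
zipWith-∷ʳ f []        []        x y = refl
zipWith-∷ʳ f (x′ ∷ xs) (y′ ∷ ys) x y = cong (f x′ y′ ∷_) (zipWith-∷ʳ f xs ys x y)

zipWith-rotN : ∀ t (f : A → B → C) (xs : Vec A m) ys →
               zipWith f (rotN t xs) (rotN t ys) ≡ rotN t (zipWith f xs ys)
zipWith-rotN zero    f xs       ys       = refl
zipWith-rotN (suc t) f []       []       = zipWith-rotN t f [] []
zipWith-rotN (suc t) f (x ∷ xs) (y ∷ ys) =
  trans (zipWith-rotN t f (xs ∷ʳ x) (ys ∷ʳ y)) (cong (rotN t) (zipWith-∷ʳ f xs ys x y))

replicate-∷ʳ : ∀ n (x : A) → replicate n x ∷ʳ x ≡ x ∷ replicate n x
replicate-∷ʳ zero    x = refl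
replicate-∷ʳ (suc n) x = cong (x ∷_) (replicate-∷ʳ n x)

rotN-replicate : ∀ t n (x : A) → rotN t (replicate n x) ≡ replicate n x
rotN-replicate zero    n       x = refl
rotN-replicate (suc t) zero    x = rotN-replicate t zero x
rotN-replicate (suc t) (suc n) x = trans (cong (rotN t) (replicate-∷ʳ n x)) (rotN-replicate t (suc n) x)

rotL : List A → List A
rotL List.[]       = List.[]
rotL (x List.∷ xs) = xs ++ [ x ]

rotNL : ℕ → List A → List A
rotNL zero    xs = xs
rotNL (suc t) xs = rotNL t (rotL xs)

toList-rotN : ∀ t (xs : Vec A m) → toList (rotN t xs) ≡ rotNL t (toList xs)
toList-rotN zero    xs       = refl
toList-rotN (suc t) []       = toList-rotN t []
toList-rotN (suc t) (x ∷ xs) = trans (toList-rotN t (xs ∷ʳ x)) (cong (rotNL t) (Vec.toList-∷ʳ x xs))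

rotNL-++ : (xs ys : List A) → rotNL (length xs) (xs ++ ys) ≡ ys ++ xs
rotNL-++ List.[]       ys = sym (List.++-identityʳ ys)
rotNL-++ (x List.∷ xs) ys = begin
  rotNL (length xs) ((xs ++ ys) ++ [ x ]) ≡⟨ cong (rotNL (length xs)) (List.++-assoc xs ys [ x ]) ⟩
  rotNL (length xs) (xs ++ (ys ++ [ x ])) ≡⟨ rotNL-++ xs (ys ++ [ x ]) ⟩
  (ys ++ [ x ]) ++ xs                     ≡⟨ List.++-assoc ys [ x ] xs ⟩
  ys ++ (x List.∷ xs)                     ∎
  where open ≡-Reasoning

toList-injective : (xs ys : Vec A m) → toList xs ≡ toList ys → xs ≡ ys
toList-injective xs ys eq = trans (sym (cast-is-id refl xs)) (Vec.toList-injective refl xs ys eq)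

rotN-period : (xs : Vec A m) → rotN m xs ≡ xs
rotN-period {m = m} xs = toList-injective (rotN m xs) xs (begin
  toList (rotN m xs)                                ≡⟨ toList-rotN m xs ⟩
  rotNL m (toList xs)
    ≡⟨ cong₂ rotNL (Vec.length-toList xs) (List.++-identityʳ (toList xs)) ⟨
  rotNL (length (toList xs)) (toList xs ++ List.[]) ≡⟨ rotNL-++ (toList xs) List.[] ⟩
  toList xs                                         ∎)
  where open ≡-Reasoning

rotN-*-period : ∀ q (xs : Vec A m) → rotN (q * m) xs ≡ xs
rotN-*-period zero            xs = refl
rotN-*-period {m = m} (suc q) xs =
  trans (rotN-+ m (q * m) xs) (trans (cong (rotN (q * m)) (rotN-period xs)) (rotN-*-period q xs))

rotN-% : ∀ t (xs : Vec A (suc m)) → rotN t xs ≡ rotN (t % suc m) xs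
rotN-% {m = m} t xs = begin
  rotN t xs                                      ≡⟨ cong (λ u → rotN u xs) (m≡m%n+[m/n]*n t (suc m)) ⟩
  rotN (t % suc m + t / suc m * suc m) xs        ≡⟨ rotN-+ (t % suc m) (t / suc m * suc m) xs ⟩
  rotN (t / suc m * suc m) (rotN (t % suc m) xs) ≡⟨ rotN-*-period (t / suc m) (rotN (t % suc m) xs) ⟩
  rotN (t % suc m) xs                            ∎
  where open ≡-Reasoning

rotN-undo : ∀ b (xs : Vec A (suc m)) → rotN (b * m) (rotN b xs) ≡ xs
rotN-undo {m = m} b xs = begin
  rotN (b * m) (rotN b xs) ≡⟨ rotN-+ b (b * m) xs ⟨
  rotN (b + b * m) xs      ≡⟨ cong (λ t → rotN t xs) (*-suc b m) ⟨
  rotN (b * suc m) xs      ≡⟨ rotN-*-period b xs ⟩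
  xs                       ∎
  where open ≡-Reasoning

Aperiodic : Vec A m → Set
Aperiodic {m = m} v = ∀ i → 1 ≤ i → i < m → rotN i v ≢ v

Aperiodic-rotN : ∀ a {v : Vec A m} → Aperiodic v → Aperiodic (rotN a v)
Aperiodic-rotN a {v} ap i 1≤i i<m eq = ap i 1≤i i<m (rotN-injective a _ _ (trans (rotN-comm a i v) eq))

Aperiodic-map : ∀ (f : A → B) {v : Vec A m} → Aperiodic (map f v) → Aperiodic v
Aperiodic-map f {v} ap i 1≤i i<m eq = ap i 1≤i i<m (trans (sym (map-rotN i f v)) (cong (map f) eq))

-- lexmin

module _ {a ℓ₁ ℓ₂} (O : StrictTotalOrder a ℓ₁ ℓ₂) where
  open StrictTotalOrder O using (_≈_; compare; <-respˡ-≈) renaming (_<_ to _≺_; trans to ≺-trans)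

  ≮-trans : ∀ {x y z} → ¬ x ≺ y → ¬ y ≺ z → ¬ x ≺ z
  ≮-trans {x} {y} x≮y y≮z x<z with compare x y
  ... | tri< x<y _ _ = x≮y x<y
  ... | tri≈ _ x≈y _ = y≮z (<-respˡ-≈ x≈y x<z)
  ... | tri> _ _ y<x = y≮z (≺-trans y<x x<z)

  ≮-antisym : ∀ {x y} → ¬ x ≺ y → ¬ y ≺ x → x ≈ y
  ≮-antisym {x} {y} x≮y y≮x with compare x y
  ... | tri< x<y _ _ = ⊥-elim (x≮y x<y)
  ... | tri≈ _ x≈y _ = x≈y
  ... | tri> _ _ y<x = ⊥-elim (y≮x y<x)

_<?W_ : (P Q : Pattern k m n) → Dec (P <W Q)
_<?W_ {k} {m} {n} = StrictTotalOrder._<?_ (WordOrder k m n)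

≈W⇒≡ : {P Q : Pattern k m n} → Pointwise (Pointwise _≡_) P Q → P ≡ Q
≈W⇒≡ Pointwise.[]         = refl
≈W⇒≡ (r≈s Pointwise.∷ rs) = cong₂ _∷_ (Pointwise-≡⇒≡ r≈s) (≈W⇒≡ rs)

<W-irrefl : {P : Pattern k m n} → ¬ (P <W P)
<W-irrefl {k} {m} {n} = StrictTotalOrder.irrefl (WordOrder k m n) (StrictTotalOrder.Eq.refl (WordOrder k m n))

≮W-antisym : {P Q : Pattern k m n} → ¬ (P <W Q) → ¬ (Q <W P) → P ≡ Q
≮W-antisym {k} {m} {n} P≮Q Q≮P = ≈W⇒≡ (≮-antisym (WordOrder k m n) P≮Q Q≮P)

-- Invariant of the loop `lexminGo j c b` of lexmin, which compares the j
-- rotations c, rot c, … with the least pattern b found so far and returns r.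
record LexminScan (j : ℕ) (c b r : Pattern k m n) : Set where
  field
    is-candidate : r ≡ b ⊎ ∃ λ t → r ≡ rotN t c
    ≮-best       : ¬ (b <W r)
    ≮-visited    : ∀ t → t < j → ¬ (rotN t c <W r)

scan-start : {c b : Pattern k m n} → LexminScan 0 c b b
scan-start = record { is-candidate = inj₁ refl ; ≮-best = <W-irrefl ; ≮-visited = λ _ () }

scan-keep : ∀ {j} {c b r : Pattern k m n} →
            ¬ (c <W b) → LexminScan j (rot c) b r → LexminScan (suc j) c b r
scan-keep {k} {m} {n} c≮b s = record
  { is-candidate = map₂ (λ { (t , eq) → suc t , eq }) is-candidate
  ; ≮-best       = ≮-best
  ; ≮-visited    = λ { zero    _         → ≮-trans (WordOrder k m n) c≮b ≮-best
                     ; (suc t) (s≤s t<j) → ≮-visited t t<j }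
  }
  where open LexminScan s

scan-replace : ∀ {j} {c b r : Pattern k m n} →
               c <W b → LexminScan j (rot c) c r → LexminScan (suc j) c b r
scan-replace {k} {m} {n} {c = c} {r = r} c<b s = record
  { is-candidate = inj₂ (as-rotation is-candidate)
  ; ≮-best       = λ b<r → ≮-best (StrictTotalOrder.trans (WordOrder k m n) c<b b<r)
  ; ≮-visited    = λ { zero    _         → ≮-best
                     ; (suc t) (s≤s t<j) → ≮-visited t t<j }
  }
  where
  open LexminScan s
  as-rotation : r ≡ c ⊎ (∃ λ t → r ≡ rotN t (rot c)) → ∃ λ t → r ≡ rotN t c
  as-rotation (inj₁ eq)       = 0 , eq
  as-rotation (inj₂ (t , eq)) = suc t , eq

module _ (step : ℕ → (c b : Pattern k m n) → Dec (c <W b) → Pattern k m n)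
         (step-0-<   : ∀ c b c<b → step zero c b (yes c<b) ≡ c)
         (step-0-≮   : ∀ c b c≮b → step zero c b (no c≮b) ≡ b)
         (step-suc-< : ∀ j c b c<b → step (suc j) c b (yes c<b) ≡ step j (rot c) c (rot c <?W c))
         (step-suc-≮ : ∀ j c b c≮b → step (suc j) c b (no c≮b) ≡ step j (rot c) b (rot c <?W b))
         where

  step-scan : ∀ j c b d → LexminScan (suc j) c b (step j c b d)
  step-scan zero    c b (yes c<b) rewrite step-0-< c b c<b     = scan-replace c<b scan-start
  step-scan zero    c b (no c≮b)  rewrite step-0-≮ c b c≮b     = scan-keep c≮b scan-start
  step-scan (suc j) c b (yes c<b) rewrite step-suc-< j c b c<b = scan-replace c<b (step-scan j (rot c) c _)
  step-scan (suc j) c b (no c≮b)  rewrite step-suc-≮ j c b c≮b = scan-keep c≮b (step-scan j (rot c) b _)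

scan-keep′ : ∀ {j L} {c b r : Pattern k L n} → suc j ≡ L → rot b ≡ c → ¬ (b <W b) →
             LexminScan j c b r → LexminScan L b b r
scan-keep′ refl refl = scan-keep

-- lexminGo is private to Defs. The meta lexminStep is solved, by unification
-- in lexmin-scan, to the with-function of the recursive clause of lexminGo,
-- which satisfies the equations of step-scan by refl. The length is abstracted
-- to L there to make this a pattern unification problem.
mutual
  lexminStep : ∀ {k L n} → ℕ → (c b : Pattern k L n) → Dec (c <W b) → Pattern k L n
  lexminStep = _

  lexmin-scan : (P : Pattern k (suc m) n) → LexminScan (suc m) P P (lexmin P)
  lexmin-scan P with P <?W P
  ... | yes P<P = ⊥-elim (<W-irrefl P<P)
  lexmin-scan {m = zero}  P | no P≮P = scan-keep P≮P scan-start
  lexmin-scan {m = suc m} P | no P≮P with rot P in rotP≡c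
  ... | c with c <?W P
  ... | d with suc (suc m) in 2+m≡L
  ... | L = scan-keep′ 2+m≡L rotP≡c P≮P
              (step-scan lexminStep (λ _ _ _ → refl) (λ _ _ _ → refl)
                                    (λ _ _ _ _ → refl) (λ _ _ _ _ → refl) m c P d)

lexmin-rotation : (P : Pattern k (suc m) n) → ∃ λ a → lexmin P ≡ rotN a P
lexmin-rotation P with LexminScan.is-candidate (lexmin-scan P)
... | inj₁ eq       = 0 , eq
... | inj₂ rotation = rotation

lexmin-minimal : (P : Pattern k (suc m) n) → ∀ {Q} t → Q ≡ rotN t P → ¬ (Q <W lexmin P)
lexmin-minimal {m = m} P t refl rewrite rotN-% t P =
  LexminScan.≮-visited (lexmin-scan P) (t % suc m) (m%n<n t (suc m))

lexmin-rotN : (P : Pattern k (suc m) n) → ∀ b → lexmin (rotN b P) ≡ lexmin P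
lexmin-rotN {m = m} P b with lexmin-rotation P | lexmin-rotation (rotN b P)
... | a , eq | a′ , eq′ = ≮W-antisym
  (lexmin-minimal P (b + a′) (trans eq′ (sym (rotN-+ b a′ P))))
  (lexmin-minimal (rotN b P) (b * m + a) (trans eq (sym (begin
    rotN (b * m + a) (rotN b P)      ≡⟨ rotN-+ (b * m) a (rotN b P) ⟩
    rotN a (rotN (b * m) (rotN b P)) ≡⟨ cong (rotN a) (rotN-undo b P) ⟩
    rotN a P                         ∎))))
  where open ≡-Reasoning

lexmin-≡⇒rotN-≡ : (X Y : Pattern k (suc m) n) → lexmin X ≡ lexmin Y →
                  ∃₂ λ a b → ∀ (f : Vec (Fin k) n → B) → rotN a (map f X) ≡ rotN b (map f Y)
lexmin-≡⇒rotN-≡ X Y eq with lexmin-rotation X | lexmin-rotation Y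
... | a , eqX | b , eqY = a , b , λ f →
  trans (sym (map-rotN a f X)) (trans (cong (map f) (trans (sym eqX) (trans eq eqY))) (map-rotN b f Y))

lexmin-rowLyndon : (X : Pattern k (suc m) n) → Aperiodic X → RowLyndon (lexmin X)
lexmin-rowLyndon {k} {m} {n} X ap i 1≤i i<m with lexmin-rotation X
... | a , eq with StrictTotalOrder.compare (WordOrder k (suc m) n) (lexmin X) (rotN i (lexmin X))
... | tri< lt _ _   = lt
... | tri≈ _ same _ =
  ⊥-elim (Aperiodic-rotN a ap i 1≤i i<m (subst (λ Y → rotN i Y ≡ Y) eq (sym (≈W⇒≡ same))))
... | tri> _ _ gt   =
  ⊥-elim (lexmin-minimal X (a + i) (trans (cong (rotN i) eq) (sym (rotN-+ a i X))) gt)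

-- Columns

col : Vec A m → Vec (Vec A 1) m
col = map (_∷ [])

map-head-col : (v : Vec A m) → map head (col v) ≡ v
map-head-col []      = refl
map-head-col (x ∷ v) = cong (x ∷_) (map-head-col v)

col-map-head : (R : Vec (Vec A 1) m) → col (map head R) ≡ R
col-map-head []             = refl
col-map-head ((x ∷ []) ∷ R) = cong ((x ∷ []) ∷_) (col-map-head R)

last-hcatCol : (Q : Pattern k m n) (R : Pattern k m 1) → map last (hcatCol Q R) ≡ map head R
last-hcatCol []      []      = refl
last-hcatCol (r ∷ Q) (c ∷ R) = cong₂ _∷_ (Vec.last-∷ʳ (head c) r) (last-hcatCol Q R)

last-hcatCol-col : (Q : Pattern k m n) (E : Vec (Fin k) m) → map last (hcatCol Q (col E)) ≡ E
last-hcatCol-col Q E = trans (last-hcatCol Q (col E)) (map-head-col E)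

penultimate-hcatCol : (Q : Pattern k m (suc n)) (R : Pattern k m 1) →
                      map (λ r → last (init r)) (hcatCol Q R) ≡ map last Q
penultimate-hcatCol []      []      = refl
penultimate-hcatCol (r ∷ Q) (c ∷ R) =
  cong₂ _∷_ (cong last (Vec.init-∷ʳ (head c) r)) (penultimate-hcatCol Q R)

hcat-head-tail : (Q : Pattern k m (suc n)) → hcat (map (λ r → head r ∷ []) Q) (map tail Q) ≡ Q
hcat-head-tail []            = refl
hcat-head-tail ((x ∷ r) ∷ Q) = cong ((x ∷ r) ∷_) (hcat-head-tail Q)

Aperiodic-hcatCol : (Q : Pattern k m n) {E : Vec (Fin k) m} → Aperiodic E → Aperiodic (hcatCol Q (col E))
Aperiodic-hcatCol Q {E} ap = Aperiodic-map last (subst Aperiodic (sym (last-hcatCol-col Q E)) ap)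

shiftIn : Vec (Fin k) m → Pattern k m (suc n) → Pattern k m (suc n)
shiftIn E Q = hcatCol (map tail Q) (col E)

shiftIn-rotN : ∀ a (E : Vec (Fin k) m) (Q : Pattern k m (suc n)) →
               shiftIn (rotN a E) (rotN a Q) ≡ rotN a (shiftIn E Q)
shiftIn-rotN a E Q = begin
  hcatCol (map tail (rotN a Q)) (col (rotN a E))
    ≡⟨ cong₂ hcatCol (map-rotN a tail Q) (map-rotN a (_∷ []) E) ⟩
  hcatCol (rotN a (map tail Q)) (rotN a (col E)) ≡⟨ zipWith-rotN a _ (map tail Q) (col E) ⟩
  rotN a (shiftIn E Q)                           ∎
  where open ≡-Reasoning

slide : A → Vec A n → Vec A n
slide e []       = []
slide e (x ∷ xs) = xs ∷ʳ e

slides : ℕ → A → Vec A n → Vec A n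
slides zero    e xs = xs
slides (suc s) e xs = slides s e (slide e xs)

slides-∷ʳ : ∀ s (e : A) (xs : Vec A n) → slides s e (xs ∷ʳ e) ≡ slides s e xs ∷ʳ e
slides-∷ʳ zero    e xs       = refl
slides-∷ʳ (suc s) e []       = slides-∷ʳ s e []
slides-∷ʳ (suc s) e (x ∷ xs) = slides-∷ʳ s e (xs ∷ʳ e)

slides-length : (e : A) (xs : Vec A n) → slides n e xs ≡ replicate n e
slides-length             e []       = refl
slides-length {n = suc n} e (x ∷ xs) =
  trans (slides-∷ʳ n e xs) (trans (cong (_∷ʳ e) (slides-length e xs)) (replicate-∷ʳ n e))

shifts : ℕ → Vec (Fin k) m → Pattern k m (suc n) → Pattern k m (suc n)
shifts zero    E Q = Q
shifts (suc s) E Q = shifts s E (shiftIn E Q)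

shifts-∷ : ∀ s e (E : Vec (Fin k) m) (r : Vec (Fin k) (suc n)) Q →
           shifts s (e ∷ E) (r ∷ Q) ≡ slides s e r ∷ shifts s E Q
shifts-∷ zero    e E r       Q = refl
shifts-∷ (suc s) e E (x ∷ r) Q = shifts-∷ s e E (r ∷ʳ e) (shiftIn E Q)

shifts-[] : ∀ s → shifts {k} {n = n} s [] [] ≡ []
shifts-[] zero    = refl
shifts-[] (suc s) = shifts-[] s

shifts-width : (E : Vec (Fin k) m) (Q : Pattern k m (suc n)) →
               shifts (suc n) E Q ≡ map (replicate (suc n)) E
shifts-width {n = n} []      []      = shifts-[] (suc n)
shifts-width {n = n} (e ∷ E) (r ∷ Q) =
  trans (shifts-∷ (suc n) e E r Q) (cong₂ _∷_ (slides-length e r) (shifts-width E Q))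

-- The ring graph

oneAtEnd : ∀ j → Vec (Fin (suc (suc k))) (suc j)
oneAtEnd j = replicate j Fin.zero ∷ʳ Fin.suc Fin.zero

replicate≢oneAtEnd : ∀ j → replicate (suc j) Fin.zero ≢ oneAtEnd {k} j
replicate≢oneAtEnd zero    ()
replicate≢oneAtEnd (suc j) eq = replicate≢oneAtEnd j (cong tail eq)

below-oneAtEnd : ∀ j (R : Pattern (suc (suc k)) (suc j) 1) → R <W col (oneAtEnd j) →
                 map head R ≡ replicate (suc j) Fin.zero
below-oneAtEnd zero    ((Fin.zero ∷ [])  ∷ []) (this (this _ _) _)         = refl
below-oneAtEnd zero    ((Fin.suc x ∷ []) ∷ []) (this (this (s≤s ()) _) _)
below-oneAtEnd zero    ((x ∷ [])         ∷ []) (this (next _ (base ())) _)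
below-oneAtEnd zero    ((x ∷ [])         ∷ []) (next _ (base ()))
below-oneAtEnd (suc j) ((x ∷ []) ∷ R) (this (this () _) _)
below-oneAtEnd (suc j) ((x ∷ []) ∷ R) (this (next _ (base ())) _)
below-oneAtEnd (suc j) ((x ∷ []) ∷ R) (next (x≡0 Pointwise.∷ _) R<D) =
  cong₂ _∷_ x≡0 (below-oneAtEnd j R R<D)

replicate-++ : ∀ a b (x : A) → List.replicate a x ++ List.replicate b x ≡ List.replicate (a + b) x
replicate-++ zero    b x = refl
replicate-++ (suc a) b x = cong (x List.∷_) (replicate-++ a b x)

Aperiodic-oneAtEnd : ∀ j → Aperiodic (oneAtEnd {k} j)
Aperiodic-oneAtEnd {k} j (suc i) _ (s≤s 1+i≤j) eq =
  0≢1 (List.∷ʳ-injectiveʳ (tail-block ++ zeros i) (zeros j) (begin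
    (tail-block ++ zeros i) ++ [ 0F ] ≡⟨ toList-rotated ⟨
    toList (rotN (suc i) D)           ≡⟨ cong toList eq ⟩
    toList D                          ≡⟨ toList-D ⟩
    zeros j ++ [ 1F ]                 ∎))
  where
  open ≡-Reasoning
  0F 1F : Fin (suc (suc k))
  0F = Fin.zero
  1F = Fin.suc Fin.zero
  0≢1 : 0F ≢ 1F
  0≢1 ()
  D = oneAtEnd {k} j
  zeros : ℕ → List (Fin (suc (suc k)))
  zeros t = List.replicate t 0F
  tail-block = zeros (j ∸ suc i) ++ [ 1F ]
  toList-D : toList D ≡ zeros j ++ [ 1F ]
  toList-D = trans (Vec.toList-∷ʳ 1F (replicate j 0F)) (cong (_++ [ 1F ]) (Vec.toList-replicate j 0F))
  zeros-split : zeros j ≡ zeros (suc i) ++ zeros (j ∸ suc i)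
  zeros-split = trans (cong zeros (sym (m+[n∸m]≡n 1+i≤j))) (sym (replicate-++ (suc i) (j ∸ suc i) 0F))
  zeros-snoc : zeros (suc i) ≡ zeros i ++ [ 0F ]
  zeros-snoc = trans (cong zeros (+-comm 1 i)) (sym (replicate-++ i 1 0F))
  toList-D-split : toList D ≡ zeros (suc i) ++ tail-block
  toList-D-split = begin
    toList D                                           ≡⟨ toList-D ⟩
    zeros j ++ [ 1F ]                                  ≡⟨ cong (_++ [ 1F ]) zeros-split ⟩
    (zeros (suc i) ++ zeros (j ∸ suc i)) ++ [ 1F ]     ≡⟨ List.++-assoc (zeros (suc i)) _ [ 1F ] ⟩
    zeros (suc i) ++ tail-block                        ∎
  toList-rotated : toList (rotN (suc i) D) ≡ (tail-block ++ zeros i) ++ [ 0F ]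
  toList-rotated = begin
    toList (rotN (suc i) D)                            ≡⟨ toList-rotN (suc i) D ⟩
    rotNL (suc i) (toList D)
      ≡⟨ cong₂ rotNL (sym (List.length-replicate (suc i))) toList-D-split ⟩
    rotNL (length (zeros (suc i))) (zeros (suc i) ++ tail-block) ≡⟨ rotNL-++ (zeros (suc i)) tail-block ⟩
    tail-block ++ zeros (suc i)                        ≡⟨ cong (tail-block ++_) zeros-snoc ⟩
    tail-block ++ (zeros i ++ [ 0F ])                  ≡⟨ List.++-assoc tail-block (zeros i) [ 0F ] ⟨
    (tail-block ++ zeros i) ++ [ 0F ]                  ∎

LeastLabel : Pattern k m (suc n) → Pattern k m 1 → Set
LeastLabel {k} {m} P R =
  ¬ ∃ λ (R′ : Pattern k m 1) → R′ <W R × lexmin (hcatCol P R′) ≡ lexmin (hcatCol P R)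

leastLabel-oneAtEnd : (Q : Pattern (suc (suc k)) (suc m) (suc n)) → LeastLabel Q (col (oneAtEnd m))
leastLabel-oneAtEnd {m = m} Q (R , R<D , same)
  with lexmin-≡⇒rotN-≡ (hcatCol Q R) (hcatCol Q (col (oneAtEnd m))) same
... | a , b , eq = replicate≢oneAtEnd m (rotN-injective b zeros D (begin
  rotN b zeros                          ≡⟨ rotN-replicate b (suc m) Fin.zero ⟩
  zeros                                 ≡⟨ rotN-replicate a (suc m) Fin.zero ⟨
  rotN a zeros                          ≡⟨ cong (rotN a) (below-oneAtEnd m R R<D) ⟨
  rotN a (map head R)                   ≡⟨ cong (rotN a) (last-hcatCol Q R) ⟨
  rotN a (map last (hcatCol Q R))       ≡⟨ eq last ⟩
  rotN b (map last (hcatCol Q (col D))) ≡⟨ cong (rotN b) (last-hcatCol-col Q D) ⟩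
  rotN b D                              ∎))
  where
  open ≡-Reasoning
  D = oneAtEnd m
  zeros = replicate (suc m) Fin.zero

leastLabel-lastColumn : (Q : Pattern k (suc m) (suc n)) (E : Vec (Fin k) (suc m)) →
                        map last Q ≡ E → LeastLabel Q (col E)
leastLabel-lastColumn Q E lastQ≡E (R , R<E , same)
  with lexmin-≡⇒rotN-≡ (hcatCol Q R) (hcatCol Q (col E)) same
... | a , b , eq = <W-irrefl (subst (_<W col E) R≡E R<E)
  where
  open ≡-Reasoning
  penultimate≡E : ∀ R → map (λ r → last (init r)) (hcatCol Q R) ≡ E
  penultimate≡E R = trans (penultimate-hcatCol Q R) lastQ≡E
  rotN-a≡rotN-b : rotN a E ≡ rotN b E
  rotN-a≡rotN-b = subst₂ (λ X Y → rotN a X ≡ rotN b Y) (penultimate≡E R) (penultimate≡E (col E))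
                    (eq (λ r → last (init r)))
  heads≡E : map head R ≡ E
  heads≡E = rotN-injective a (map head R) E (begin
    rotN a (map head R)                   ≡⟨ cong (rotN a) (last-hcatCol Q R) ⟨
    rotN a (map last (hcatCol Q R))       ≡⟨ eq last ⟩
    rotN b (map last (hcatCol Q (col E))) ≡⟨ cong (rotN b) (last-hcatCol-col Q E) ⟩
    rotN b E                              ≡⟨ rotN-a≡rotN-b ⟨
    rotN a E                              ∎)
  R≡E : R ≡ col E
  R≡E = trans (sym (col-map-head R)) (cong col heads≡E)

ringAdj-shiftIn : ∀ {c} (u w : Vertex k (suc m) c) (E : Vec (Fin k) (suc m)) → Aperiodic E →
                  LeastLabel (proj₁ u) (col E) → proj₁ w ≡ lexmin (shiftIn E (proj₁ u)) →
                  RingAdj k (suc m) c u w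
ringAdj-shiftIn (Q , _) w E aperiodic least w≡ =
  col E , heads , map tail Q , sym (hcat-head-tail Q) , w≡ , lyndon , least′
  where
  heads = map (λ r → head r ∷ []) Q
  lyndon : RowLyndon (lexmin (hcatCol (hcat heads (map tail Q)) (col E)))
  lyndon rewrite hcat-head-tail Q = lexmin-rowLyndon (hcatCol Q (col E)) (Aperiodic-hcatCol Q aperiodic)
  least′ : LeastLabel (hcat heads (map tail Q)) (col E)
  least′ rewrite hcat-head-tail Q = least

vertexOf : ∀ {c} → Pattern k m (suc c) → Vertex k m c
vertexOf X = lexmin X , X , refl

module _ {k m c : ℕ} where
  private
    D    = oneAtEnd {k} m
    Ring = RingAdj (suc (suc k)) (suc m) c

  walk-step : (v : Vertex (suc (suc k)) (suc m) c) → ∀ a X → proj₁ v ≡ rotN a X →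
              LeastLabel (proj₁ v) (col (rotN a D)) → Ring v (vertexOf (shiftIn D X))
  walk-step v a X v≡ least =
    ringAdj-shiftIn v (vertexOf (shiftIn D X)) (rotN a D) (Aperiodic-rotN a (Aperiodic-oneAtEnd m)) least
      (begin
        lexmin (shiftIn D X)                   ≡⟨ lexmin-rotN (shiftIn D X) a ⟨
        lexmin (rotN a (shiftIn D X))          ≡⟨ cong lexmin (shiftIn-rotN a D X) ⟨
        lexmin (shiftIn (rotN a D) (rotN a X)) ≡⟨ cong (λ Y → lexmin (shiftIn (rotN a D) Y)) v≡ ⟨
        lexmin (shiftIn (rotN a D) (proj₁ v))  ∎)
    where open ≡-Reasoning

  -- X is the pattern obtained by appending D without normalising, and v is X
  -- rotated by a; so the label rotN a D leads to a rotation of shiftIn D X.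
  walk : ∀ r (v : Vertex (suc (suc k)) (suc m) c) → ∀ a X → proj₁ v ≡ rotN a X →
         LeastLabel (proj₁ v) (col (rotN a D)) → EqClosure Ring v (vertexOf (shifts (suc r) D X))
  walk zero    v a X v≡ least = fwd (walk-step v a X v≡ least) ◅ ε
  walk (suc r) v a X v≡ least with lexmin-rotation (shiftIn D X)
  ... | a′ , eq′ =
    fwd (walk-step v a X v≡ least) ◅
    walk r (vertexOf (shiftIn D X)) a′ (shiftIn D X) eq′ (leastLabel-lastColumn _ (rotN a′ D) lastColumn)
    where
    lastColumn : map last (lexmin (shiftIn D X)) ≡ rotN a′ D
    lastColumn = begin
      map last (lexmin (shiftIn D X))   ≡⟨ cong (map last) eq′ ⟩
      map last (rotN a′ (shiftIn D X))  ≡⟨ map-rotN a′ last (shiftIn D X) ⟩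
      rotN a′ (map last (shiftIn D X))  ≡⟨ cong (rotN a′) (last-hcatCol-col (map tail X) D) ⟩
      rotN a′ D                         ∎
      where open ≡-Reasoning

  connected-to-constant : (u : Vertex (suc (suc k)) (suc m) c) →
                          EqClosure Ring u (vertexOf (map (replicate (suc c)) D))
  connected-to-constant u = subst (λ X → EqClosure Ring u (vertexOf X)) (shifts-width D (proj₁ u))
    (walk c u 0 (proj₁ u) refl (leastLabel-oneAtEnd (proj₁ u)))

ringGraph-weaklyConnected : ∀ k m c → RingGraphWeaklyConnected (suc (suc k)) (suc m) c
ringGraph-weaklyConnected k m c u v =
  EqClosure.transitive _ (connected-to-constant u) (EqClosure.symmetric _ (connected-to-constant v))

lemma3 : ∀ (k m n : ℕ) → 2 ≤ k → 2 ≤ m → 2 ≤ n → RingGraphWeaklyConnected k m (n ∸ 2)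
lemma3 (suc (suc k)) (suc m) n _ _ _ = ringGraph-weaklyConnected k m (n ∸ 2)
lemma3 (suc (suc k)) zero    n _ () _
lemma3 (suc zero)    m       n (s≤s ()) _ _
lemma3 zero          m       n () _ _
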